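{- Let $q$ be a prime, $N$ an integer with $0 \le N < q$, and $H, P$ real numbers with $1 \le P \le H < q/2$. Let $\mathscr{P}$ be the set of primes $p$ with $P < p \le 2P$. For each integer $m$ let \[ \mathcal{A}(m) = \#\left\{ (a, p) : p \in \mathscr{P},\ a \in \mathbb{Z},\ 0 \le a < p,\ \frac{N - aq}{p} - \frac{H}{P} < m \le \frac{N - aq}{p} \right\}. \] Then $\mathcal{A}(m) = 0$ unless $|m| \le 2q$. Moreover, setting $S_1 = \sum_{m \in \mathbb{Z}} \mathcal{A}(m)$ and $S_2 = \sum_{m \in \mathbb{Z}} \mathcal{A}(m)^2$, if $HP < q$ then $S_1 \le S_2 \ll HP$, with an absolute implied constant.
   Formalization: The parameters H and P are taken in the rationals rather than the reals. -}

module Defs where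

open import Data.Nat as ℕ using (ℕ; suc)
open import Data.Nat.Primality using (Prime; prime?)
open import Data.Integer as ℤ using (ℤ; +_)
open import Data.Rational as ℚ using (ℚ; _/_; _÷_; _-_; _<_; _≤_; NonZero)
open import Data.Rational.Properties using (_<?_; _≤?_)
open import Data.List using (List; upTo; map; concatMap; filter; length)
open import Data.Nat.ListAction using (sum)
open import Data.Product using (_×_; _,_)
open import Relation.Nullary.Decidable using (_×-dec_)
import Relation.Nullary.Decidable

ℤ→ℚ : ℤ → ℚ
ℤ→ℚ z = z / 1

ℕ→ℚ : ℕ → ℚ
ℕ→ℚ n = (+ n) / 1

-- Candidate pairs (a , k) standing for (a , p) with p = suc k, where
-- 1 ≤ p ≤ q and 0 ≤ a < p.  Every prime p with P < p ≤ 2P satisfies p ≤ q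
-- under the standing hypothesis 2P ≤ 2H < q, so this list contains every
-- pair counted by 𝒜(m).
pairs : ℕ → List (ℕ × ℕ)
pairs q = concatMap (λ k → map (λ a → (a , k)) (upTo (suc k))) (upTo q)

Cond : (q N : ℕ) (H P : ℚ) .{{_ : NonZero P}} (m : ℤ) → ℕ × ℕ → Set
Cond q N H P m (a , k) =
  Prime (suc k) × (P < ℕ→ℚ (suc k) × (ℕ→ℚ (suc k) ≤ ℕ→ℚ 2 ℚ.* P ×
  (((+ N ℤ.- + (a ℕ.* q)) / suc k) - (H ÷ P) < ℤ→ℚ m ×
   ℤ→ℚ m ≤ ((+ N ℤ.- + (a ℕ.* q)) / suc k))))

cond? : (q N : ℕ) (H P : ℚ) .{{_ : NonZero P}} (m : ℤ) (x : ℕ × ℕ) →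
        Relation.Nullary.Decidable.Dec (Cond q N H P m x)
cond? q N H P m (a , k) =
  prime? (suc k) ×-dec (P <? ℕ→ℚ (suc k) ×-dec (ℕ→ℚ (suc k) ≤? ℕ→ℚ 2 ℚ.* P ×-dec
  ((((+ N ℤ.- + (a ℕ.* q)) / suc k) - (H ÷ P) <? ℤ→ℚ m) ×-dec
   (ℤ→ℚ m ≤? ((+ N ℤ.- + (a ℕ.* q)) / suc k)))))

𝒜 : (q N : ℕ) (H P : ℚ) .{{_ : NonZero P}} (m : ℤ) → ℕ
𝒜 q N H P m = length (filter (cond? q N H P m) (pairs q))

window : ℕ → List ℤ
window q = map (λ i → + i ℤ.- + (2 ℕ.* q)) (upTo (suc (4 ℕ.* q)))

-- S₁ = Σ_m 𝒜(m), S₂ = Σ_m 𝒜(m)², summed over |m| ≤ 2q (which contains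
-- the support of 𝒜 by the first part of the lemma)
S₁ : (q N : ℕ) (H P : ℚ) .{{_ : NonZero P}} → ℕ
S₁ q N H P = sum (map (𝒜 q N H P) (window q))

S₂ : (q N : ℕ) (H P : ℚ) .{{_ : NonZero P}} → ℕ
S₂ q N H P = sum (map (λ m → 𝒜 q N H P m ℕ.* 𝒜 q N H P m) (window q))

{-# OPTIONS --safe #-}
-- Write p = k + 1 and D = N - a q - p m.  The pair (a , p) is counted in 𝒜(m) exactly when
-- p ∈ 𝒫 and 0 ≤ D < p H / P; as p H / P ≤ 2H < q, this gives 0 ≤ D < q and hence |m| < q.
--
-- Expanding the square, S₂ = Σ_{p , p′} T(p , p′), where T counts the triples (a , a′ , m) with
-- (a , p) and (a′ , p′) both counted in 𝒜(m).  For a fixed pair (a , p) the admissible m lie in an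
-- interval of length H / P, so every (a , a′) contributes at most ⌊H / P⌋ + 1.  If p = p′ then
-- a′ = a, because both values of D lie in [0 , q) and differ by a multiple of q; so
-- T(p , p) ≤ p (⌊H / P⌋ + 1).  If p ≠ p′, then q times the difference of two values of a p′ - a′ p
-- is a signed sum of four values of p D or p′ D, each in [0 , 4 H P) ⊆ [0 , 4 q); so a p′ - a′ p
-- ranges over at most 15 integers, and it determines (a , a′) as p and p′ are distinct primes.
-- Hence T(p , p′) ≤ 15 (⌊H / P⌋ + 1), and summing over the O(P) primes of 𝒫 gives
-- S₂ ≪ P² · H / P = H P.  Finally S₁ ≤ S₂ as 𝒜(m) ≤ 𝒜(m)².
module Submission where

open import Defs
open import Data.Integer as ℤ using (ℤ; +_; -[1+_]; 0ℤ; ∣_∣)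
import Data.Integer.Properties as ℤ
open import Data.Integer.Tactic.RingSolver using () renaming (solve-∀ to ℤ-solve-∀)
open import Data.List using (List; []; _∷_; [_]; map; filter; length; upTo; applyUpTo; concatMap; _∷ʳ_)
import Data.List.Properties as List
open import Data.Nat as ℕ using (ℕ; zero; suc; _+_; _*_; _∸_; _≤_; _<_; z≤n; _≟_; _≤?_)
open import Data.Nat.Coprimality using (1-coprimeTo) renaming (sym to coprime-sym)
open import Data.Nat.Divisibility using (_∣_; _∤_; ∣m+n∣m⇒∣n; n∣m*n; >⇒∤)
import Data.Nat.DivMod as ℕ
open import Data.Nat.ListAction using (sum)
open import Data.Nat.ListAction.Properties using (sum-++)
open import Data.Nat.Primality using (Prime; euclidsLemma; prime⇒irreducible; prime⇒nonTrivial; prime⇒nonZero)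
import Data.Nat.Properties as ℕ
open import Data.Nat.Tactic.RingSolver using () renaming (solve-∀ to ℕ-solve-∀)
open import Data.Product using (_×_; _,_; proj₁; proj₂; Σ; ∃-syntax)
open import Data.Rational as ℚ using (ℚ; NonZero; mkℚ; 0ℚ; 1ℚ; _/_; _÷_)
import Data.Rational.Properties as ℚ
open import Data.Rational.Solver using (module +-*-Solver)
import Data.Rational.Unnormalised as ℚᵘ
import Data.Rational.Unnormalised.Properties as ℚᵘ
open import Data.Sum using (inj₁; inj₂)
open import Algebra.Properties.CommutativeSemigroup ℕ.+-commutativeSemigroup using () renaming (interchange to +-interchange)
open import Function using (_∘_)
open import Level using (Level)
open import Relation.Binary.PropositionalEquality
  using (_≡_; _≢_; refl; sym; trans; cong; cong₂; subst; subst₂; module ≡-Reasoning)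
open import Relation.Nullary using (Dec; yes; no; contradiction)
open import Relation.Nullary.Decidable using (_×-dec_)
open import Relation.Unary using (Pred; Decidable)

private variable
  ℓ ℓ′ : Level
  A : Set ℓ

-- Indicators and finite sums

𝟙 : Dec A → ℕ
𝟙 (yes _) = 1
𝟙 (no _)  = 0

𝟙≤1 : (a? : Dec A) → 𝟙 a? ≤ 1
𝟙≤1 (yes _) = ℕ.≤-refl
𝟙≤1 (no _)  = z≤n

𝟙*n≤n : (a? : Dec A) (n : ℕ) → 𝟙 a? * n ≤ n
𝟙*n≤n a? n = ℕ.≤-trans (ℕ.*-monoˡ-≤ n (𝟙≤1 a?)) (ℕ.≤-reflexive (ℕ.*-identityˡ n))

𝟙-yes : (a? : Dec A) → A → 𝟙 a? ≡ 1
𝟙-yes (yes _) _ = refl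
𝟙-yes (no ¬a) a = contradiction a ¬a

𝟙≢0⇒ : (a? : Dec A) → 𝟙 a? ≢ 0 → A
𝟙≢0⇒ (yes a) _   = a
𝟙≢0⇒ (no _)  1≢0 = contradiction refl 1≢0

m*n≢0⇒m≢0 : ∀ m n → m * n ≢ 0 → m ≢ 0
m*n≢0⇒m≢0 m n mn≢0 refl = mn≢0 refl

m*n≢0⇒n≢0 : ∀ m n → m * n ≢ 0 → n ≢ 0
m*n≢0⇒n≢0 m n mn≢0 refl = mn≢0 (ℕ.*-zeroʳ m)

≤-if-≢0 : ∀ {m n} → (m ≢ 0 → m ≤ n) → m ≤ n
≤-if-≢0 {zero}  _ = z≤n
≤-if-≢0 {suc m} h = h (λ ())

∑ : ℕ → (ℕ → ℕ) → ℕ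
∑ zero    f = 0
∑ (suc n) f = ∑ n f + f n

infix 5 ∑
syntax ∑ n (λ i → e) = ∑[ i < n ] e

module _ {f g : ℕ → ℕ} where

  ∑-cong : ∀ n → (∀ {i} → i < n → f i ≡ g i) → ∑ n f ≡ ∑ n g
  ∑-cong zero    _  = refl
  ∑-cong (suc n) eq = cong₂ _+_ (∑-cong n (eq ∘ ℕ.m<n⇒m<1+n)) (eq (ℕ.n<1+n n))

  ∑-mono-≤ : ∀ n → (∀ {i} → i < n → f i ≤ g i) → ∑ n f ≤ ∑ n g
  ∑-mono-≤ zero    _  = z≤n
  ∑-mono-≤ (suc n) le = ℕ.+-mono-≤ (∑-mono-≤ n (le ∘ ℕ.m<n⇒m<1+n)) (le (ℕ.n<1+n n))

  ∑-distrib-+ : ∀ n → ∑[ i < n ] (f i + g i) ≡ ∑ n f + ∑ n g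
  ∑-distrib-+ zero    = refl
  ∑-distrib-+ (suc n) =
    trans (cong (_+ (f n + g n)) (∑-distrib-+ n)) (+-interchange (∑ n f) (∑ n g) (f n) (g n))

∑-zero : ∀ n → ∑[ i < n ] 0 ≡ 0
∑-zero zero    = refl
∑-zero (suc n) = cong (_+ 0) (∑-zero n)

∑-const : ∀ n c → ∑[ i < n ] c ≡ n * c
∑-const zero    c = refl
∑-const (suc n) c = trans (cong (_+ c) (∑-const n c)) (ℕ.+-comm (n * c) c)

∑-comm : ∀ m n (f : ℕ → ℕ → ℕ) → ∑[ i < m ] ∑[ j < n ] f i j ≡ ∑[ j < n ] ∑[ i < m ] f i j
∑-comm zero    n f = sym (∑-zero n)
∑-comm (suc m) n f = trans (cong (_+ ∑ n (f m)) (∑-comm m n f)) (sym (∑-distrib-+ n))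

*-distribˡ-∑ : ∀ c n (f : ℕ → ℕ) → c * ∑ n f ≡ ∑[ i < n ] (c * f i)
*-distribˡ-∑ c zero    f = ℕ.*-zeroʳ c
*-distribˡ-∑ c (suc n) f =
  trans (ℕ.*-distribˡ-+ c (∑ n f) (f n)) (cong (_+ c * f n) (*-distribˡ-∑ c n f))

*-distribʳ-∑ : ∀ c n (f : ℕ → ℕ) → ∑ n f * c ≡ ∑[ i < n ] (f i * c)
*-distribʳ-∑ c n f = begin
  ∑ n f * c             ≡⟨ ℕ.*-comm (∑ n f) c ⟩
  c * ∑ n f             ≡⟨ *-distribˡ-∑ c n f ⟩
  ∑[ i < n ] (c * f i)  ≡⟨ ∑-cong n (λ {i} _ → ℕ.*-comm c (f i)) ⟩
  ∑[ i < n ] (f i * c)  ∎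
  where open ≡-Reasoning

≤-∑ : ∀ n (f : ℕ → ℕ) {i} → i < n → f i ≤ ∑ n f
≤-∑ (suc n) f {i} i<1+n with i ≟ n
... | yes refl = ℕ.m≤n+m (f i) (∑ n f)
... | no i≢n   = ℕ.≤-trans (≤-∑ n f (ℕ.≤∧≢⇒< (ℕ.≤-pred i<1+n) i≢n)) (ℕ.m≤m+n (∑ n f) (f n))

∑≢0⇒ : ∀ n (f : ℕ → ℕ) → ∑ n f ≢ 0 → ∃[ i ] i < n × f i ≢ 0
∑≢0⇒ zero    f ∑≢0 = contradiction refl ∑≢0
∑≢0⇒ (suc n) f ∑≢0 with f n ≟ 0
... | no fn≢0 = n , ℕ.n<1+n n , fn≢0
... | yes fn≡0 with ∑≢0⇒ n f (λ ∑≡0 → ∑≢0 (cong₂ _+_ ∑≡0 fn≡0))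
...   | i , i<n , fi≢0 = i , ℕ.m<n⇒m<1+n i<n , fi≢0

∑-≤-supportFrom : ∀ n (f : ℕ → ℕ) {B lo} → (∀ {i} → i < n → f i ≤ B) →
                  (∀ {i} → i < n → f i ≢ 0 → lo ≤ i) → ∑ n f ≤ (n ∸ lo) * B
∑-≤-supportFrom zero    f bound support = z≤n
∑-≤-supportFrom (suc n) f {B} {lo} bound support with lo ≤? n
... | yes lo≤n = begin
  ∑ n f + f n        ≤⟨ ℕ.+-mono-≤ ih (bound (ℕ.n<1+n n)) ⟩
  (n ∸ lo) * B + B   ≡⟨ ℕ.+-comm ((n ∸ lo) * B) B ⟩
  suc (n ∸ lo) * B   ≡⟨ cong (_* B) (ℕ.+-∸-assoc 1 lo≤n) ⟨
  (suc n ∸ lo) * B   ∎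
  where
  open ℕ.≤-Reasoning
  ih : ∑ n f ≤ (n ∸ lo) * B
  ih = ∑-≤-supportFrom n f (bound ∘ ℕ.m<n⇒m<1+n) (support ∘ ℕ.m<n⇒m<1+n)
... | no lo≰n = begin
  ∑ n f + f n        ≤⟨ ℕ.+-mono-≤ ih fn≤0 ⟩
  (n ∸ lo) * B + 0   ≡⟨ ℕ.+-identityʳ ((n ∸ lo) * B) ⟩
  (n ∸ lo) * B       ≤⟨ ℕ.*-monoˡ-≤ B (ℕ.∸-monoˡ-≤ lo (ℕ.n≤1+n n)) ⟩
  (suc n ∸ lo) * B   ∎
  where
  open ℕ.≤-Reasoning
  ih : ∑ n f ≤ (n ∸ lo) * B
  ih = ∑-≤-supportFrom n f (bound ∘ ℕ.m<n⇒m<1+n) (support ∘ ℕ.m<n⇒m<1+n)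
  fn≤0 : f n ≤ 0
  fn≤0 = ≤-if-≢0 λ fn≢0 → contradiction (support (ℕ.n<1+n n) fn≢0) lo≰n

∑-≤-diameter : ∀ n (f : ℕ → ℕ) {B} L → (∀ {i} → i < n → f i ≤ B) →
               (∀ {i j} → i < n → j < n → f i ≢ 0 → f j ≢ 0 → j ≤ i + L) →
               ∑ n f ≤ suc L * B
∑-≤-diameter zero    f L bound diam = z≤n
∑-≤-diameter (suc n) f {B} L bound diam with f n ≟ 0
... | yes fn≡0 = begin
  ∑ n f + f n   ≡⟨ cong (∑ n f ℕ.+_) fn≡0 ⟩
  ∑ n f + 0     ≡⟨ ℕ.+-identityʳ (∑ n f) ⟩
  ∑ n f         ≤⟨ ∑-≤-diameter n f L (bound ∘ ℕ.m<n⇒m<1+n)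
                     (λ i<n j<n → diam (ℕ.m<n⇒m<1+n i<n) (ℕ.m<n⇒m<1+n j<n)) ⟩
  suc L * B     ∎
  where open ℕ.≤-Reasoning
... | no fn≢0 = begin
  ∑ n f + f n                ≤⟨ ℕ.+-mono-≤ head (bound (ℕ.n<1+n n)) ⟩
  (n ∸ (n ∸ L)) * B + B      ≤⟨ ℕ.+-monoˡ-≤ B (ℕ.*-monoˡ-≤ B width) ⟩
  L * B + B                  ≡⟨ ℕ.+-comm (L * B) B ⟩
  suc L * B                  ∎
  where
  open ℕ.≤-Reasoning
  near : ∀ {i} → i < n → f i ≢ 0 → n ∸ L ≤ i
  near {i} i<n fi≢0 = ℕ.m≤n+o⇒m∸n≤o n L
    (ℕ.≤-trans (diam (ℕ.m<n⇒m<1+n i<n) (ℕ.n<1+n n) fi≢0 fn≢0) (ℕ.≤-reflexive (ℕ.+-comm i L)))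
  head : ∑ n f ≤ (n ∸ (n ∸ L)) * B
  head = ∑-≤-supportFrom n f (bound ∘ ℕ.m<n⇒m<1+n) near
  width : n ∸ (n ∸ L) ≤ L
  width = ℕ.m≤n+o⇒m∸n≤o n (n ∸ L)
    (ℕ.≤-trans (ℕ.m≤n+m∸n n L) (ℕ.≤-reflexive (ℕ.+-comm L (n ∸ L))))

∑-≤-subsingleton : ∀ n (f : ℕ → ℕ) {B} → (∀ {i} → i < n → f i ≤ B) →
                   (∀ {i j} → i < n → j < n → f i ≢ 0 → f j ≢ 0 → i ≡ j) → ∑ n f ≤ B
∑-≤-subsingleton n f {B} bound unique = ℕ.≤-trans
  (∑-≤-diameter n f 0 bound λ i<n j<n fi≢0 fj≢0 →
    ℕ.≤-reflexive (trans (sym (unique i<n j<n fi≢0 fj≢0)) (sym (ℕ.+-identityʳ _))))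
  (ℕ.≤-reflexive (ℕ.+-identityʳ B))

-- Split the double sum along the fibres of ψ; each fibre meets the support in at most one point.
∑∑-≤-injective : ∀ m n (g ψ : ℕ → ℕ → ℕ) {B} w →
  (∀ {a b} → a < m → b < n → g a b ≤ B) →
  (∀ {a b} → a < m → b < n → g a b ≢ 0 → ψ a b < w) →
  (∀ {a b a′ b′} → a < m → b < n → a′ < m → b′ < n → g a b ≢ 0 → g a′ b′ ≢ 0 →
     ψ a b ≡ ψ a′ b′ → a ≡ a′ × b ≡ b′) →
  ∑[ a < m ] ∑[ b < n ] g a b ≤ w * B
∑∑-≤-injective m n g ψ {B} w bound range injective = begin
  ∑[ a < m ] ∑[ b < n ] g a b                  ≤⟨ ∑-mono-≤ m (λ a<m → ∑-mono-≤ n (λ b<n → g≤fibres a<m b<n)) ⟩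
  ∑[ a < m ] ∑[ b < n ] ∑[ t < w ] fibre t a b  ≡⟨ ∑-cong m (λ {a} _ → ∑-comm n w (λ b t → fibre t a b)) ⟩
  ∑[ a < m ] ∑[ t < w ] ∑[ b < n ] fibre t a b  ≡⟨ ∑-comm m w (λ a t → ∑[ b < n ] fibre t a b) ⟩
  ∑[ t < w ] ∑[ a < m ] ∑[ b < n ] fibre t a b  ≤⟨ ∑-mono-≤ w (λ _ → fibre-≤ _) ⟩
  ∑[ t < w ] B                                  ≡⟨ ∑-const w B ⟩
  w * B                                         ∎
  where
  open ℕ.≤-Reasoning
  fibre : ℕ → ℕ → ℕ → ℕ
  fibre t a b = 𝟙 (ψ a b ≟ t) * g a b

  fibre≢0⇒ : ∀ {t a b} → fibre t a b ≢ 0 → ψ a b ≡ t × g a b ≢ 0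
  fibre≢0⇒ {t} {a} {b} ≢0 =
    𝟙≢0⇒ (ψ a b ≟ t) (m*n≢0⇒m≢0 _ _ ≢0) , m*n≢0⇒n≢0 (𝟙 (ψ a b ≟ t)) _ ≢0

  g≤fibres : ∀ {a b} → a < m → b < n → g a b ≤ ∑[ t < w ] fibre t a b
  g≤fibres {a} {b} a<m b<n = ≤-if-≢0 λ gab≢0 → begin
    g a b                         ≡⟨ ℕ.*-identityˡ (g a b) ⟨
    1 * g a b                     ≡⟨ cong (_* g a b) (𝟙-yes (ψ a b ≟ ψ a b) refl) ⟨
    fibre (ψ a b) a b             ≤⟨ ≤-∑ w (λ t → fibre t a b) (range a<m b<n gab≢0) ⟩
    ∑[ t < w ] fibre t a b        ∎

  fibre-≤ : ∀ t → ∑[ a < m ] ∑[ b < n ] fibre t a b ≤ B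
  fibre-≤ t = ∑-≤-subsingleton m (λ a → ∑[ b < n ] fibre t a b) row-≤ rows-unique
    where
    row-≤ : ∀ {a} → a < m → ∑[ b < n ] fibre t a b ≤ B
    row-≤ {a} a<m = ∑-≤-subsingleton n (fibre t a)
      (λ b<n → ℕ.≤-trans (𝟙*n≤n (ψ a _ ≟ t) _) (bound a<m b<n))
      (λ b<n b′<n ≢0 ≢0′ → let (ψ≡t , g≢0) = fibre≢0⇒ ≢0 ; (ψ≡t′ , g≢0′) = fibre≢0⇒ ≢0′ in
        proj₂ (injective a<m b<n a<m b′<n g≢0 g≢0′ (trans ψ≡t (sym ψ≡t′))))
    rows-unique : ∀ {a a′} → a < m → a′ < m →
                  ∑[ b < n ] fibre t a b ≢ 0 → ∑[ b < n ] fibre t a′ b ≢ 0 → a ≡ a′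
    rows-unique {a} {a′} a<m a′<m ≢0 ≢0′
      with ∑≢0⇒ n (fibre t a) ≢0 | ∑≢0⇒ n (fibre t a′) ≢0′
    ... | b , b<n , f≢0 | b′ , b′<n , f≢0′ =
      let (ψ≡t , g≢0) = fibre≢0⇒ f≢0 ; (ψ≡t′ , g≢0′) = fibre≢0⇒ f≢0′ in
      proj₁ (injective a<m b<n a′<m b′<n g≢0 g≢0′ (trans ψ≡t (sym ψ≡t′)))

∑-*-∑ : ∀ m n (f g : ℕ → ℕ) → ∑ m f * ∑ n g ≡ ∑[ i < m ] ∑[ j < n ] f i * g j
∑-*-∑ m n f g = trans (*-distribʳ-∑ (∑ n g) m f) (∑-cong m λ {i} _ → *-distribˡ-∑ (f i) n g)

∑-≤-except : ∀ n (f g : ℕ → ℕ) k → (∀ {j} → j < n → j ≢ k → f j ≤ g j) → ∑ n f ≤ f k + ∑ n g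
∑-≤-except zero    f g k _  = z≤n
∑-≤-except (suc n) f g k le with n ≟ k
... | yes refl = begin
  ∑ n f + f n          ≤⟨ ℕ.+-monoˡ-≤ (f n) (∑-mono-≤ n (λ j<n → le (ℕ.m<n⇒m<1+n j<n) (ℕ.<⇒≢ j<n))) ⟩
  ∑ n g + f n          ≡⟨ ℕ.+-comm (∑ n g) (f n) ⟩
  f n + ∑ n g          ≤⟨ ℕ.+-monoʳ-≤ (f n) (ℕ.m≤m+n (∑ n g) (g n)) ⟩
  f n + (∑ n g + g n)  ∎
  where open ℕ.≤-Reasoning
... | no n≢k = begin
  ∑ n f + f n          ≤⟨ ℕ.+-mono-≤ (∑-≤-except n f g k (le ∘ ℕ.m<n⇒m<1+n)) (le (ℕ.n<1+n n) n≢k) ⟩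
  f k + ∑ n g + g n    ≡⟨ ℕ.+-assoc (f k) (∑ n g) (g n) ⟩
  f k + (∑ n g + g n)  ∎
  where open ℕ.≤-Reasoning

n≤n*n : ∀ n → n ≤ n * n
n≤n*n zero    = z≤n
n≤n*n (suc n) = ℕ.m≤m*n (suc n) (suc n)

length-filter≡sum-𝟙 : {P : Pred A ℓ′} (P? : Decidable P) (xs : List A) →
                      length (filter P? xs) ≡ sum (map (𝟙 ∘ P?) xs)
length-filter≡sum-𝟙 P? []       = refl
length-filter≡sum-𝟙 P? (x ∷ xs) with P? x
... | yes _ = cong suc (length-filter≡sum-𝟙 P? xs)
... | no _  = length-filter≡sum-𝟙 P? xs

sum-concatMap : (f : A → List ℕ) (xs : List A) → sum (concatMap f xs) ≡ sum (map (sum ∘ f) xs)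
sum-concatMap f []       = refl
sum-concatMap f (x ∷ xs) = trans (sum-++ (f x) (concatMap f xs)) (cong (sum (f x) ℕ.+_) (sum-concatMap f xs))

sum-applyUpTo : ∀ (f : ℕ → ℕ) n → sum (applyUpTo f n) ≡ ∑ n f
sum-applyUpTo f zero    = refl
sum-applyUpTo f (suc n) = begin
  sum (applyUpTo f (suc n))        ≡⟨ cong sum (List.applyUpTo-∷ʳ f n) ⟨
  sum (applyUpTo f n ∷ʳ f n)       ≡⟨ sum-++ (applyUpTo f n) [ f n ] ⟩
  sum (applyUpTo f n) + (f n + 0)  ≡⟨ cong₂ _+_ (sum-applyUpTo f n) (ℕ.+-identityʳ (f n)) ⟩
  ∑ n f + f n                      ∎
  where open ≡-Reasoning

sum-map-upTo : ∀ (f : ℕ → ℕ) n → sum (map f (upTo n)) ≡ ∑ n f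
sum-map-upTo f n = trans (cong sum (List.map-applyUpTo (λ i → i) f n)) (sum-applyUpTo f n)

sum-map-pairs : ∀ q (f : ℕ × ℕ → ℕ) → sum (map f (pairs q)) ≡ ∑[ k < q ] ∑[ a < suc k ] f (a , k)
sum-map-pairs q f = begin
  sum (map f (pairs q))                                          ≡⟨ cong sum (List.map-concatMap f row (upTo q)) ⟩
  sum (concatMap (map f ∘ row) (upTo q))                         ≡⟨ sum-concatMap (map f ∘ row) (upTo q) ⟩
  sum (map (sum ∘ map f ∘ row) (upTo q))                         ≡⟨ cong sum (List.map-cong sum-row (upTo q)) ⟩
  sum (map (λ k → ∑[ a < suc k ] f (a , k)) (upTo q))            ≡⟨ sum-map-upTo _ q ⟩
  ∑[ k < q ] ∑[ a < suc k ] f (a , k)                            ∎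
  where
  open ≡-Reasoning
  row : ℕ → List (ℕ × ℕ)
  row k = map (_, k) (upTo (suc k))
  sum-row : ∀ k → sum (map f (row k)) ≡ ∑[ a < suc k ] f (a , k)
  sum-row k = trans (cong sum (sym (List.map-∘ (upTo (suc k))))) (sum-map-upTo _ (suc k))

sum-map-window : ∀ q (f : ℤ → ℕ) → sum (map f (window q)) ≡ ∑[ i < suc (4 * q) ] f (+ i ℤ.- + (2 * q))
sum-map-window q f = trans (cong sum (sym (List.map-∘ (upTo (suc (4 * q)))))) (sum-map-upTo _ (suc (4 * q)))

-- Integer arithmetic

module _ {p p′} (prime-p : Prime p) (prime-p′ : Prime p′) (p≢p′ : p ≢ p′) where

  private
    p∤p′ : p ∤ p′
    p∤p′ p∣p′ with prime⇒irreducible prime-p′ p∣p′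
    ... | inj₁ p≡1 = contradiction p≡1 (ℕ.>⇒≢ (ℕ.nonTrivial⇒n>1 p {{prime⇒nonTrivial prime-p}}))
    ... | inj₂ p≡p′ = p≢p′ p≡p′

    p∣d*p′⇒d≡0 : ∀ {d} → d < p → p ∣ d * p′ → d ≡ 0
    p∣d*p′⇒d≡0 {zero}  _   _      = refl
    p∣d*p′⇒d≡0 {suc d} d<p p∣dp′ with euclidsLemma (suc d) p′ prime-p p∣dp′
    ... | inj₁ p∣d  = contradiction p∣d (>⇒∤ d<p)
    ... | inj₂ p∣p′ = contradiction p∣p′ p∤p′

    b≤a⇒a≡b : ∀ {a b a′ b′} → b ≤ a → a < p → a * p′ + b′ * p ≡ b * p′ + a′ * p → a ≡ b
    b≤a⇒a≡b {a} {b} {a′} {b′} b≤a a<p eq = begin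
      a             ≡⟨ ℕ.m∸n+n≡m b≤a ⟨
      a ∸ b + b     ≡⟨ cong (_+ b) (p∣d*p′⇒d≡0 (ℕ.≤-<-trans (ℕ.m∸n≤m a b) a<p) p∣dp′) ⟩
      b             ∎
      where
      open ≡-Reasoning
      d : ℕ
      d = a ∸ b
      regroup : ∀ d b p′ b′p → (d + b) * p′ + b′p ≡ b * p′ + (d * p′ + b′p)
      regroup = ℕ-solve-∀
      dp′+b′p≡a′p : d * p′ + b′ * p ≡ a′ * p
      dp′+b′p≡a′p = ℕ.+-cancelˡ-≡ (b * p′) _ _ (begin
        b * p′ + (d * p′ + b′ * p)  ≡⟨ regroup d b p′ (b′ * p) ⟨
        (d + b) * p′ + b′ * p       ≡⟨ cong (λ x → x * p′ + b′ * p) (ℕ.m∸n+n≡m b≤a) ⟩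
        a * p′ + b′ * p             ≡⟨ eq ⟩
        b * p′ + a′ * p             ∎)
      p∣dp′ : p ∣ d * p′
      p∣dp′ = ∣m+n∣m⇒∣n (subst (p ∣_) (trans (sym dp′+b′p≡a′p) (ℕ.+-comm (d * p′) (b′ * p))) (n∣m*n a′))
                          (n∣m*n b′)

  -- a p′ + b′ p = b p′ + a′ p determines a mod p, hence a, and then a′.
  crossᴺ-injective : ∀ {a b a′ b′} → a < p → b < p → a * p′ + b′ * p ≡ b * p′ + a′ * p → a ≡ b × a′ ≡ b′
  crossᴺ-injective {a} {b} {a′} {b′} a<p b<p eq = a≡b , a′≡b′
    where
    instance
      p≢0 : ℕ.NonZero p
      p≢0 = prime⇒nonZero prime-p
    a≡b : a ≡ b
    a≡b with ℕ.≤-total b a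
    ... | inj₁ b≤a = b≤a⇒a≡b {a′ = a′} {b′} b≤a a<p eq
    ... | inj₂ a≤b = sym (b≤a⇒a≡b {a′ = b′} {a′} a≤b b<p (sym eq))
    a′≡b′ : a′ ≡ b′
    a′≡b′ = ℕ.*-cancelʳ-≡ a′ b′ p
      (sym (ℕ.+-cancelˡ-≡ (a * p′) _ _ (trans eq (cong (λ x → x * p′ + a′ * p) (sym a≡b)))))

<-by-scaledDifference : ∀ c {d e x y} .{{_ : ℤ.NonNegative c}} →
  c ℤ.* d ≡ x ℤ.- y → x ℤ.< c ℤ.* e → 0ℤ ℤ.≤ y → d ℤ.< e
<-by-scaledDifference c {x = x} {y} eq x<ce 0≤y = ℤ.*-cancelˡ-<-nonNeg c
  (subst (ℤ._< _) (sym eq) (ℤ.≤-<-trans (ℤ.i-j≤i x y {{ℤ.nonNegative 0≤y}}) x<ce))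

i-j<1+k⇒i≤j+k : ∀ {i j} k → i ℤ.- j ℤ.< + suc k → i ℤ.≤ j ℤ.+ + k
i-j<1+k⇒i≤j+k {i} {j} k i-j<1+k = subst₂ ℤ._≤_ (cancel i j) (ℤ.+-comm (+ k) j)
  (ℤ.+-monoˡ-≤ j (ℤ.i<j⇒i≤pred[j] i-j<1+k))
  where
  cancel : ∀ i j → i ℤ.- j ℤ.+ j ≡ i
  cancel = ℤ-solve-∀

∣i∣<n : ∀ {i n} → i ℤ.< + n → ℤ.- i ℤ.< + n → ∣ i ∣ < n
∣i∣<n {+ _}      i<n  _    = ℤ.drop‿+<+ i<n
∣i∣<n { -[1+ _ ]} _   -i<n = ℤ.drop‿+<+ -i<n

0≤n*i : ∀ n {i} → 0ℤ ℤ.≤ i → 0ℤ ℤ.≤ + n ℤ.* i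
0≤n*i n {i} 0≤i = subst (ℤ._≤ + n ℤ.* i) (ℤ.*-zeroʳ (+ n)) (ℤ.*-monoˡ-≤-nonNeg (+ n) 0≤i)

cross : ℕ → ℕ → ℕ → ℕ → ℤ
cross p p′ a a′ = + a ℤ.* + p′ ℤ.- + a′ ℤ.* + p

cross-injective : ∀ {p p′ a a′ b b′} → Prime p → Prime p′ → p ≢ p′ → a < p → b < p →
                  cross p p′ a a′ ≡ cross p p′ b b′ → a ≡ b × a′ ≡ b′
cross-injective {p} {p′} {a} {a′} {b} {b′} prime-p prime-p′ p≢p′ a<p b<p eq =
  crossᴺ-injective prime-p prime-p′ p≢p′ a<p b<p (ℤ.+-injective (begin
    + (a * p′ + b′ * p)            ≡⟨ pos-*+* a p′ b′ p ⟩
    + a ℤ.* + p′ ℤ.+ + b′ ℤ.* + p  ≡⟨ transpose (+ a ℤ.* + p′) (+ a′ ℤ.* + p) (+ b ℤ.* + p′) (+ b′ ℤ.* + p) eq ⟩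
    + b ℤ.* + p′ ℤ.+ + a′ ℤ.* + p  ≡⟨ pos-*+* b p′ a′ p ⟨
    + (b * p′ + a′ * p)            ∎))
  where
  open ≡-Reasoning
  pos-*+* : ∀ x y z w → + (x * y + z * w) ≡ + x ℤ.* + y ℤ.+ + z ℤ.* + w
  pos-*+* x y z w = trans (ℤ.pos-+ (x * y) (z * w)) (cong₂ ℤ._+_ (ℤ.pos-* x y) (ℤ.pos-* z w))
  transpose : ∀ x y z w → x ℤ.- y ≡ z ℤ.- w → x ℤ.+ w ≡ z ℤ.+ y
  transpose x y z w eq = begin
    x ℤ.+ w                  ≡⟨ shift x y w ⟩
    (x ℤ.- y) ℤ.+ (y ℤ.+ w)  ≡⟨ cong (ℤ._+ (y ℤ.+ w)) eq ⟩
    (z ℤ.- w) ℤ.+ (y ℤ.+ w)  ≡⟨ unshift z w y ⟩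
    z ℤ.+ y                  ∎
    where
    shift : ∀ x y w → x ℤ.+ w ≡ (x ℤ.- y) ℤ.+ (y ℤ.+ w)
    shift = ℤ-solve-∀
    unshift : ∀ z w y → (z ℤ.- w) ℤ.+ (y ℤ.+ w) ≡ z ℤ.+ y
    unshift = ℤ-solve-∀

module _ (q N : ℕ) where

  offset : ℕ → ℕ → ℤ → ℤ
  offset a p m = + N ℤ.- + a ℤ.* + q ℤ.- + p ℤ.* m

  offset-diameter : ∀ {a p m₁ m₂} L → offset a p m₁ ℤ.< + p ℤ.* + suc L → 0ℤ ℤ.≤ offset a p m₂ →
                    m₂ ℤ.- m₁ ℤ.< + suc L
  offset-diameter {a} {p} {m₁} {m₂} L = <-by-scaledDifference (+ p) (shift (+ N ℤ.- + a ℤ.* + q) (+ p) m₁ m₂)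
    where
    shift : ∀ A p m₁ m₂ → p ℤ.* (m₂ ℤ.- m₁) ≡ (A ℤ.- p ℤ.* m₁) ℤ.- (A ℤ.- p ℤ.* m₂)
    shift = ℤ-solve-∀

  offset-<q⇒≤ : ∀ {a a′ p m} → offset a p m ℤ.< + q → 0ℤ ℤ.≤ offset a′ p m → a′ ≤ a
  offset-<q⇒≤ {a} {a′} {p} {m} D<q 0≤D′ =
    ℕ.≤-trans (ℤ.drop‿+≤+ (i-j<1+k⇒i≤j+k {j = + a} 0 a′-a<1)) (ℕ.≤-reflexive (ℕ.+-identityʳ a))
    where
    shift : ∀ N a a′ q pm → q ℤ.* (a′ ℤ.- a) ≡ (N ℤ.- a ℤ.* q ℤ.- pm) ℤ.- (N ℤ.- a′ ℤ.* q ℤ.- pm)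
    shift = ℤ-solve-∀
    a′-a<1 : + a′ ℤ.- + a ℤ.< + 1
    a′-a<1 = <-by-scaledDifference (+ q) (shift (+ N) (+ a) (+ a′) (+ q) (+ p ℤ.* m))
      (subst (offset a p m ℤ.<_) (sym (ℤ.*-identityʳ (+ q))) D<q) 0≤D′

  cross-window : ∀ {p p′ a a′ b b′ m m′} →
    + p′ ℤ.* offset a p m ℤ.< + 4 ℤ.* + q → + p ℤ.* offset b′ p′ m′ ℤ.< + 4 ℤ.* + q →
    0ℤ ℤ.≤ offset a′ p′ m → 0ℤ ℤ.≤ offset b p m′ →
    cross p p′ b b′ ℤ.- cross p p′ a a′ ℤ.< + 8
  cross-window {p} {p′} {a} {a′} {b} {b′} {m} {m′} D₁<4q D₂<4q 0≤D₁′ 0≤D₂′ =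
    <-by-scaledDifference (+ q) (identity (+ N) (+ q) (+ p) (+ p′) (+ a) (+ a′) (+ b) (+ b′) m m′)
      (subst (+ p′ ℤ.* offset a p m ℤ.+ + p ℤ.* offset b′ p′ m′ ℤ.<_) (eight (+ q)) (ℤ.+-mono-< D₁<4q D₂<4q))
      (ℤ.+-mono-≤ (0≤n*i p 0≤D₁′) (0≤n*i p′ 0≤D₂′))
    where
    identity : ∀ N q p p′ a a′ b b′ m m′ →
      q ℤ.* ((b ℤ.* p′ ℤ.- b′ ℤ.* p) ℤ.- (a ℤ.* p′ ℤ.- a′ ℤ.* p)) ≡
      (p′ ℤ.* (N ℤ.- a ℤ.* q ℤ.- p ℤ.* m) ℤ.+ p ℤ.* (N ℤ.- b′ ℤ.* q ℤ.- p′ ℤ.* m′)) ℤ.-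
      (p ℤ.* (N ℤ.- a′ ℤ.* q ℤ.- p′ ℤ.* m) ℤ.+ p′ ℤ.* (N ℤ.- b ℤ.* q ℤ.- p ℤ.* m′))
    identity = ℤ-solve-∀
    eight : ∀ q → + 4 ℤ.* q ℤ.+ + 4 ℤ.* q ≡ q ℤ.* + 8
    eight = ℤ-solve-∀

  offset⇒∣m∣<q : ∀ {a p m} → N < q → a < p → 0ℤ ℤ.≤ offset a p m → offset a p m ℤ.< + q → ∣ m ∣ < q
  offset⇒∣m∣<q {a} {p} {m} N<q a<p 0≤D D<q = ∣i∣<n m<q -m<q
    where
    D : ℤ
    D = offset a p m
    instance
      p≢0 : ℕ.NonZero p
      p≢0 = ℕ.>-nonZero (ℕ.≤-<-trans z≤n a<p)
    q≤pq : + q ℤ.≤ + p ℤ.* + q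
    q≤pq = subst (+ q ℤ.≤_) (ℤ.pos-* p q) (ℤ.+≤+ (ℕ.m≤n*m q p))
    [1+a]q≤pq : + suc a ℤ.* + q ℤ.≤ + p ℤ.* + q
    [1+a]q≤pq = ℤ.*-monoʳ-≤-nonNeg (+ q) (ℤ.+≤+ a<p)
    shift₁ : ∀ N a q p m → p ℤ.* m ≡ (N ℤ.- (N ℤ.- a ℤ.* q ℤ.- p ℤ.* m)) ℤ.- a ℤ.* q
    shift₁ = ℤ-solve-∀
    shift₂ : ∀ N a q p m → p ℤ.* (ℤ.- m) ≡ ((N ℤ.- a ℤ.* q ℤ.- p ℤ.* m) ℤ.+ a ℤ.* q) ℤ.- N
    shift₂ = ℤ-solve-∀
    q+aq : ∀ a q → q ℤ.+ a ℤ.* q ≡ (+ 1 ℤ.+ a) ℤ.* q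
    q+aq = ℤ-solve-∀
    m<q : m ℤ.< + q
    m<q = <-by-scaledDifference (+ p) (shift₁ (+ N) (+ a) (+ q) (+ p) m)
      (ℤ.≤-<-trans (ℤ.i-j≤i (+ N) D {{ℤ.nonNegative 0≤D}}) (ℤ.<-≤-trans (ℤ.+<+ N<q) q≤pq))
      (0≤n*i a (ℤ.+≤+ ℕ.z≤n))
    -m<q : ℤ.- m ℤ.< + q
    -m<q = <-by-scaledDifference (+ p) (shift₂ (+ N) (+ a) (+ q) (+ p) m)
      (ℤ.<-≤-trans (subst (D ℤ.+ + a ℤ.* + q ℤ.<_) (q+aq (+ a) (+ q)) (ℤ.+-monoˡ-< (+ a ℤ.* + q) D<q)) [1+a]q≤pq)
      (ℤ.+≤+ ℕ.z≤n)

window-shift : ∀ {x y} k → x ℤ.- y ℤ.< + suc k → y ℤ.- x ℤ.< + suc k →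
               0ℤ ℤ.≤ x ℤ.- (y ℤ.- + k) × x ℤ.- (y ℤ.- + k) ℤ.< + suc (k + k)
window-shift {x} {y} k x-y<1+k y-x<1+k =
  subst (0ℤ ℤ.≤_) (flip x y (+ k)) (ℤ.i≤j⇒0≤j-i (ℤ.i<j⇒i≤pred[j] y-x<1+k)) ,
  subst (ℤ._< + suc (k + k)) (sym (unshift x y (+ k))) (ℤ.+-monoˡ-< (+ k) x-y<1+k)
  where
  flip : ∀ x y k → k ℤ.- (y ℤ.- x) ≡ x ℤ.- (y ℤ.- k)
  flip = ℤ-solve-∀
  unshift : ∀ x y k → x ℤ.- (y ℤ.- k) ≡ (x ℤ.- y) ℤ.+ k
  unshift = ℤ-solve-∀

∣-∣-injective-above : ∀ {x y c} → 0ℤ ℤ.≤ x ℤ.- c → 0ℤ ℤ.≤ y ℤ.- c →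
                      ∣ x ℤ.- c ∣ ≡ ∣ y ℤ.- c ∣ → x ≡ y
∣-∣-injective-above {x} {y} {c} 0≤x-c 0≤y-c eq = begin
  x                ≡⟨ shift x c ⟩
  (x ℤ.- c) ℤ.+ c  ≡⟨ cong (ℤ._+ c) x-c≡y-c ⟩
  (y ℤ.- c) ℤ.+ c  ≡⟨ shift y c ⟨
  y                ∎
  where
  open ≡-Reasoning
  shift : ∀ x c → x ≡ (x ℤ.- c) ℤ.+ c
  shift = ℤ-solve-∀
  x-c≡y-c : x ℤ.- c ≡ y ℤ.- c
  x-c≡y-c = trans (sym (ℤ.0≤i⇒+∣i∣≡i 0≤x-c)) (trans (cong +_ eq) (ℤ.0≤i⇒+∣i∣≡i 0≤y-c))

-- ℤ and ℕ inside ℚ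

ℤ→ℚ≡mkℚ : ∀ z → ℤ→ℚ z ≡ mkℚ z 0 (coprime-sym (1-coprimeTo ℤ.∣ z ∣))
ℤ→ℚ≡mkℚ z = ℚ.↥p/↧p≡p (mkℚ z 0 _)

ℤ→ℚ-homo-* : ∀ i j → ℤ→ℚ (i ℤ.* j) ≡ ℤ→ℚ i ℚ.* ℤ→ℚ j
ℤ→ℚ-homo-* i j rewrite ℤ→ℚ≡mkℚ i | ℤ→ℚ≡mkℚ j = refl

ℕ→ℚ-homo-* : ∀ m n → ℕ→ℚ (m * n) ≡ ℕ→ℚ m ℚ.* ℕ→ℚ n
ℕ→ℚ-homo-* m n = trans (cong ℤ→ℚ (ℤ.pos-* m n)) (ℤ→ℚ-homo-* (+ m) (+ n))

ℤ→ℚ-homo-+ : ∀ i j → ℤ→ℚ (i ℤ.+ j) ≡ ℤ→ℚ i ℚ.+ ℤ→ℚ j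
ℤ→ℚ-homo-+ i j rewrite ℤ→ℚ≡mkℚ i | ℤ→ℚ≡mkℚ j = cong ℤ→ℚ (*1+*1 i j)
  where
  *1+*1 : ∀ i j → i ℤ.+ j ≡ i ℤ.* + 1 ℤ.+ j ℤ.* + 1
  *1+*1 = ℤ-solve-∀

ℤ→ℚ-homo-neg : ∀ i → ℤ→ℚ (ℤ.- i) ≡ ℚ.- ℤ→ℚ i
ℤ→ℚ-homo-neg i rewrite ℤ→ℚ≡mkℚ i | ℤ→ℚ≡mkℚ (ℤ.- i) = mkℚ-neg i
  where
  mkℚ-neg : ∀ i → mkℚ (ℤ.- i) 0 (coprime-sym (1-coprimeTo ∣ ℤ.- i ∣)) ≡
                  ℚ.- mkℚ i 0 (coprime-sym (1-coprimeTo ∣ i ∣))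
  mkℚ-neg (+ zero)  = refl
  mkℚ-neg (+ suc n) = refl
  mkℚ-neg -[1+ n ]  = refl

ℤ→ℚ-homo-- : ∀ i j → ℤ→ℚ (i ℤ.- j) ≡ ℤ→ℚ i ℚ.- ℤ→ℚ j
ℤ→ℚ-homo-- i j = trans (ℤ→ℚ-homo-+ i (ℤ.- j)) (cong (ℤ→ℚ i ℚ.+_) (ℤ→ℚ-homo-neg j))

ℤ→ℚ-mono-≤ : ∀ {i j} → i ℤ.≤ j → ℤ→ℚ i ℚ.≤ ℤ→ℚ j
ℤ→ℚ-mono-≤ {i} {j} i≤j rewrite ℤ→ℚ≡mkℚ i | ℤ→ℚ≡mkℚ j = ℚ.*≤* (ℤ.*-monoʳ-≤-nonNeg (+ 1) i≤j)

ℤ→ℚ-cancel-≤ : ∀ {i j} → ℤ→ℚ i ℚ.≤ ℤ→ℚ j → i ℤ.≤ j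
ℤ→ℚ-cancel-≤ {i} {j} i≤j rewrite ℤ→ℚ≡mkℚ i | ℤ→ℚ≡mkℚ j = ℤ.*-cancelʳ-≤-pos i j (+ 1) (ℚ.drop-*≤* i≤j)

ℤ→ℚ-cancel-< : ∀ {i j} → ℤ→ℚ i ℚ.< ℤ→ℚ j → i ℤ.< j
ℤ→ℚ-cancel-< {i} {j} i<j rewrite ℤ→ℚ≡mkℚ i | ℤ→ℚ≡mkℚ j = ℤ.*-cancelʳ-<-nonNeg (+ 1) (ℚ.drop-*<* i<j)

ℕ→ℚ-nonNeg : ∀ n → ℚ.NonNegative (ℕ→ℚ n)
ℕ→ℚ-nonNeg n = ℚ.normalize-nonNeg n 1

ℕ→ℚ-pos : ∀ n → ℚ.Positive (ℕ→ℚ (suc n))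
ℕ→ℚ-pos n = ℚ.normalize-pos (suc n) 1

ℕ→ℚ[1+k]*[i/1+k]≡ℤ→ℚi : ∀ k i → ℕ→ℚ (suc k) ℚ.* (i / suc k) ≡ ℤ→ℚ i
ℕ→ℚ[1+k]*[i/1+k]≡ℤ→ℚi k i = ℚ.toℚᵘ-injective (begin
  ℚ.toℚᵘ (ℕ→ℚ (suc k) ℚ.* (i / suc k))           ≈⟨ ℚ.toℚᵘ-homo-* (ℕ→ℚ (suc k)) (i / suc k) ⟩
  ℚ.toℚᵘ (ℕ→ℚ (suc k)) ℚᵘ.* ℚ.toℚᵘ (i / suc k)   ≡⟨ cong₂ ℚᵘ._*_ (toℚᵘ-ℤ→ℚ (+ suc k)) refl ⟩
  ℚᵘ.mkℚᵘ (+ suc k) 0 ℚᵘ.* ℚ.toℚᵘ (i / suc k)     ≈⟨ ℚᵘ.*-congˡ {ℚᵘ.mkℚᵘ (+ suc k) 0} (ℚ.toℚᵘ-fromℚᵘ (ℚᵘ.mkℚᵘ i k)) ⟩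
  ℚᵘ.mkℚᵘ (+ suc k) 0 ℚᵘ.* ℚᵘ.mkℚᵘ i k           ≈⟨ ℚᵘ.*≡* (trans (cancel (+ suc k) i) (cong (λ n → i ℤ.* + n) (sym 1*p≡p))) ⟩
  ℚᵘ.mkℚᵘ i 0                                    ≡⟨ toℚᵘ-ℤ→ℚ i ⟨
  ℚ.toℚᵘ (ℤ→ℚ i)                                 ∎)
  where
  open ℚᵘ.≃-Reasoning
  toℚᵘ-ℤ→ℚ : ∀ z → ℚ.toℚᵘ (ℤ→ℚ z) ≡ ℚᵘ.mkℚᵘ z 0
  toℚᵘ-ℤ→ℚ z = cong ℚ.toℚᵘ (ℤ→ℚ≡mkℚ z)
  cancel : ∀ p i → p ℤ.* i ℤ.* + 1 ≡ i ℤ.* p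
  cancel = ℤ-solve-∀
  1*p≡p : 1 * suc k ≡ suc k
  1*p≡p = ℕ.*-identityˡ (suc k)

∃-floor : ∀ r → 0ℚ ℚ.≤ r → ∃[ n ] ℕ→ℚ n ℚ.≤ r × r ℚ.< ℕ→ℚ (suc n)
∃-floor (mkℚ (+ u) d-1 _) _ = n , n≤r , r<1+n
  where
  d = suc d-1
  n = u ℕ./ d
  n≤r : ℕ→ℚ n ℚ.≤ mkℚ (+ u) d-1 _
  n≤r rewrite ℤ→ℚ≡mkℚ (+ n) = ℚ.*≤* (subst₂ ℤ._≤_ (ℤ.pos-* n d) (ℤ.pos-* u 1)
    (ℤ.+≤+ (subst (n * d ℕ.≤_) (sym (ℕ.*-identityʳ u)) (ℕ.m/n*n≤m u d))))
  r<1+n : mkℚ (+ u) d-1 _ ℚ.< ℕ→ℚ (suc n)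
  r<1+n rewrite ℤ→ℚ≡mkℚ (+ suc n) = ℚ.*<* (subst₂ ℤ._<_ (ℤ.pos-* u 1) (ℤ.pos-* (suc n) d)
    (ℤ.+<+ (subst₂ ℕ._<_ (trans (sym (ℕ.m≡m%n+[m/n]*n u d)) (sym (ℕ.*-identityʳ u))) refl
      (ℕ.+-monoˡ-< (n * d) (ℕ.m%n<n u d)))))
∃-floor (mkℚ -[1+ _ ] _ _) 0≤r with ℚ.drop-*≤* 0≤r
... | ()

*-distribˡ-- : ∀ p x y → p ℚ.* (x ℚ.- y) ≡ p ℚ.* x ℚ.- p ℚ.* y
*-distribˡ-- p x y = trans (ℚ.*-distribˡ-+ p x (ℚ.- y)) (cong (p ℚ.* x ℚ.+_) (sym (ℚ.neg-distribʳ-* p y)))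

x-y<z⇒x-z<y : ∀ x y z → x ℚ.- y ℚ.< z → x ℚ.- z ℚ.< y
x-y<z⇒x-z<y x y z x-y<z = subst₂ ℚ._<_ (telescope x y z) (cancel y z) (ℚ.+-monoˡ-< (y ℚ.- z) x-y<z)
  where
  open +-*-Solver
  telescope : ∀ x y z → (x ℚ.- y) ℚ.+ (y ℚ.- z) ≡ x ℚ.- z
  telescope = solve 3 (λ x y z → (x :- y) :+ (y :- z) := x :- z) refl
  cancel : ∀ y z → z ℚ.+ (y ℚ.- z) ≡ y
  cancel = solve 2 (λ y z → z :+ (y :- z) := y) refl

*-mono-≤-nonNeg : ∀ {a b c d} .{{_ : ℚ.NonNegative a}} .{{_ : ℚ.NonNegative d}} →
                  a ℚ.≤ b → c ℚ.≤ d → a ℚ.* c ℚ.≤ b ℚ.* d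
*-mono-≤-nonNeg {a} {b} {c} {d} a≤b c≤d = ℚ.≤-trans (ℚ.*-monoˡ-≤-nonNeg a c≤d) (ℚ.*-monoʳ-≤-nonNeg d a≤b)

1≤x<1+n⇒1≤n : ∀ {x n} → 1ℚ ℚ.≤ x → x ℚ.< ℕ→ℚ (suc n) → 1 ≤ n
1≤x<1+n⇒1≤n {x} {n} 1≤x x<1+n = ℕ.≤-pred (ℤ.drop‿+<+ (ℤ→ℚ-cancel-< {+ 1} {+ suc n} (ℚ.≤-<-trans 1≤x x<1+n)))

-- Counting the pairs (a , p)

module Setting (q N : ℕ) (H P : ℚ) .{{_ : ℚ.NonZero P}}
               (1≤P : 1ℚ ℚ.≤ P) (P≤H : P ℚ.≤ H) (H<q/2 : H ℚ.< (+ q) / 2) where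

  r : ℚ
  r = H ÷ P

  instance
    P-pos : ℚ.Positive P
    P-pos = ℚ.positive (ℚ.<-≤-trans (ℚ.positive⁻¹ 1ℚ) 1≤P)

    H-nonNeg : ℚ.NonNegative H
    H-nonNeg = ℚ.nonNegative (ℚ.≤-trans (ℚ.nonNegative⁻¹ P {{ℚ.pos⇒nonNeg P}}) P≤H)

  r*P≡H : r ℚ.* P ≡ H
  r*P≡H = trans (ℚ.*-assoc H (ℚ.1/ P) P) (trans (cong (H ℚ.*_) (ℚ.*-inverseˡ P)) (ℚ.*-identityʳ H))

  1≤r : 1ℚ ℚ.≤ r
  1≤r = ℚ.*-cancelʳ-≤-pos P (subst₂ ℚ._≤_ (sym (ℚ.*-identityˡ P)) (sym r*P≡H) P≤H)

  instance
    r-nonNeg : ℚ.NonNegative r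
    r-nonNeg = ℚ.nonNegative (ℚ.≤-trans (ℚ.nonNegative⁻¹ 1ℚ) 1≤r)

  2H<q : ℕ→ℚ 2 ℚ.* H ℚ.< ℕ→ℚ q
  2H<q = subst (ℕ→ℚ 2 ℚ.* H ℚ.<_) (ℕ→ℚ[1+k]*[i/1+k]≡ℤ→ℚi 1 (+ q))
               (ℚ.*-monoʳ-<-pos (ℕ→ℚ 2) {{ℕ→ℚ-pos 1}} H<q/2)

  p≤2P⇒pr≤2H : ∀ p → ℕ→ℚ p ℚ.≤ ℕ→ℚ 2 ℚ.* P → ℕ→ℚ p ℚ.* r ℚ.≤ ℕ→ℚ 2 ℚ.* H
  p≤2P⇒pr≤2H p p≤2P = begin
    ℕ→ℚ p ℚ.* r             ≤⟨ ℚ.*-monoʳ-≤-nonNeg r p≤2P ⟩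
    ℕ→ℚ 2 ℚ.* P ℚ.* r       ≡⟨ ℚ.*-assoc (ℕ→ℚ 2) P r ⟩
    ℕ→ℚ 2 ℚ.* (P ℚ.* r)     ≡⟨ cong (ℕ→ℚ 2 ℚ.*_) (trans (ℚ.*-comm P r) r*P≡H) ⟩
    ℕ→ℚ 2 ℚ.* H             ∎
    where open ℚ.≤-Reasoning

  cond⇒offset : ∀ {m a k} → Cond q N H P m (a , k) →
                0ℤ ℤ.≤ offset q N a (suc k) m × ℤ→ℚ (offset q N a (suc k) m) ℚ.< ℕ→ℚ (suc k) ℚ.* r
  cond⇒offset {m} {a} {k} (_ , _ , _ , X-r<m , m≤X) = subst (0ℤ ℤ.≤_) (sym D≡) (ℤ.i≤j⇒0≤j-i pm≤num) , D<pr
    where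
    open ℚ.≤-Reasoning
    p : ℚ
    p = ℕ→ℚ (suc k)
    instance
      p-pos : ℚ.Positive p
      p-pos = ℕ→ℚ-pos k
      p-nonNeg : ℚ.NonNegative p
      p-nonNeg = ℕ→ℚ-nonNeg (suc k)
    num : ℤ
    num = + N ℤ.- + (a * q)
    X : ℚ
    X = num / suc k
    pm : ℤ
    pm = + suc k ℤ.* m
    D≡ : offset q N a (suc k) m ≡ num ℤ.- pm
    D≡ = cong (λ aq → + N ℤ.- aq ℤ.- pm) (sym (ℤ.pos-* a q))
    pX≡num : p ℚ.* X ≡ ℤ→ℚ num
    pX≡num = ℕ→ℚ[1+k]*[i/1+k]≡ℤ→ℚi k num
    pm≤num : pm ℤ.≤ num
    pm≤num = ℤ→ℚ-cancel-≤ (begin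
      ℤ→ℚ pm        ≡⟨ ℤ→ℚ-homo-* (+ suc k) m ⟩
      p ℚ.* ℤ→ℚ m   ≤⟨ ℚ.*-monoˡ-≤-nonNeg p m≤X ⟩
      p ℚ.* X       ≡⟨ pX≡num ⟩
      ℤ→ℚ num       ∎)
    num-pr<pm : ℤ→ℚ num ℚ.- p ℚ.* r ℚ.< ℤ→ℚ pm
    num-pr<pm = begin-strict
      ℤ→ℚ num ℚ.- p ℚ.* r  ≡⟨ cong (ℚ._- p ℚ.* r) pX≡num ⟨
      p ℚ.* X ℚ.- p ℚ.* r  ≡⟨ *-distribˡ-- p X r ⟨
      p ℚ.* (X ℚ.- r)      <⟨ ℚ.*-monoʳ-<-pos p X-r<m ⟩
      p ℚ.* ℤ→ℚ m          ≡⟨ ℤ→ℚ-homo-* (+ suc k) m ⟨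
      ℤ→ℚ pm               ∎
    D<pr : ℤ→ℚ (offset q N a (suc k) m) ℚ.< p ℚ.* r
    D<pr = begin-strict
      ℤ→ℚ (offset q N a (suc k) m)  ≡⟨ cong ℤ→ℚ D≡ ⟩
      ℤ→ℚ (num ℤ.- pm)              ≡⟨ ℤ→ℚ-homo-- num pm ⟩
      ℤ→ℚ num ℚ.- ℤ→ℚ pm            <⟨ x-y<z⇒x-z<y (ℤ→ℚ num) (p ℚ.* r) (ℤ→ℚ pm) num-pr<pm ⟩
      p ℚ.* r                       ∎

  cond⇒offset<q : ∀ {m a k} → Cond q N H P m (a , k) → offset q N a (suc k) m ℤ.< + q
  cond⇒offset<q {m} {a} {k} c@(_ , _ , p≤2P , _) = ℤ→ℚ-cancel-< {j = + q} (begin-strict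
    ℤ→ℚ (offset q N a (suc k) m)  <⟨ proj₂ (cond⇒offset {m} {a} {k} c) ⟩
    ℕ→ℚ (suc k) ℚ.* r             ≤⟨ p≤2P⇒pr≤2H (suc k) p≤2P ⟩
    ℕ→ℚ 2 ℚ.* H                   <⟨ 2H<q ⟩
    ℕ→ℚ q                         ∎)
    where open ℚ.≤-Reasoning

  cond⇒offset<p[1+L] : ∀ {m a k} L → r ℚ.< ℕ→ℚ (suc L) → Cond q N H P m (a , k) →
                       offset q N a (suc k) m ℤ.< + suc k ℤ.* + suc L
  cond⇒offset<p[1+L] {m} {a} {k} L r<1+L c = ℤ→ℚ-cancel-< {offset q N a (suc k) m} (begin-strict
    ℤ→ℚ (offset q N a (suc k) m)  <⟨ proj₂ (cond⇒offset {m} {a} {k} c) ⟩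
    ℕ→ℚ (suc k) ℚ.* r             <⟨ ℚ.*-monoʳ-<-pos (ℕ→ℚ (suc k)) {{ℕ→ℚ-pos k}} r<1+L ⟩
    ℕ→ℚ (suc k) ℚ.* ℕ→ℚ (suc L)   ≡⟨ ℤ→ℚ-homo-* (+ suc k) (+ suc L) ⟨
    ℤ→ℚ (+ suc k ℤ.* + suc L)     ∎)
    where open ℚ.≤-Reasoning

  cond⇒p′offset<4q : ∀ {m a k k′} → H ℚ.* P ℚ.< ℕ→ℚ q → ℕ→ℚ (suc k′) ℚ.≤ ℕ→ℚ 2 ℚ.* P →
                     Cond q N H P m (a , k) → + suc k′ ℤ.* offset q N a (suc k) m ℤ.< + 4 ℤ.* + q
  cond⇒p′offset<4q {m} {a} {k} {k′} HP<q p′≤2P c@(_ , _ , p≤2P , _) = ℤ→ℚ-cancel-< {+ suc k′ ℤ.* D} (begin-strict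
    ℤ→ℚ (+ suc k′ ℤ.* D)                  ≡⟨ ℤ→ℚ-homo-* (+ suc k′) D ⟩
    ℕ→ℚ (suc k′) ℚ.* ℤ→ℚ D                <⟨ ℚ.*-monoʳ-<-pos (ℕ→ℚ (suc k′)) (proj₂ (cond⇒offset {m} {a} {k} c)) ⟩
    ℕ→ℚ (suc k′) ℚ.* (ℕ→ℚ (suc k) ℚ.* r)  ≤⟨ ℚ.*-monoˡ-≤-nonNeg (ℕ→ℚ (suc k′)) (p≤2P⇒pr≤2H (suc k) p≤2P) ⟩
    ℕ→ℚ (suc k′) ℚ.* (ℕ→ℚ 2 ℚ.* H)        ≤⟨ ℚ.*-monoʳ-≤-nonNeg (ℕ→ℚ 2 ℚ.* H) p′≤2P ⟩
    (ℕ→ℚ 2 ℚ.* P) ℚ.* (ℕ→ℚ 2 ℚ.* H)       ≡⟨ regroup (ℕ→ℚ 2) P H ⟩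
    ℕ→ℚ 4 ℚ.* (H ℚ.* P)                   <⟨ ℚ.*-monoʳ-<-pos (ℕ→ℚ 4) HP<q ⟩
    ℕ→ℚ 4 ℚ.* ℕ→ℚ q                       ≡⟨ ℤ→ℚ-homo-* (+ 4) (+ q) ⟨
    ℤ→ℚ (+ 4 ℤ.* + q)                     ∎)
    where
    open ℚ.≤-Reasoning
    open +-*-Solver
    D : ℤ
    D = offset q N a (suc k) m
    instance
      p′-pos : ℚ.Positive (ℕ→ℚ (suc k′))
      p′-pos = ℕ→ℚ-pos k′
      p′-nonNeg : ℚ.NonNegative (ℕ→ℚ (suc k′))
      p′-nonNeg = ℕ→ℚ-nonNeg (suc k′)
      4-pos : ℚ.Positive (ℕ→ℚ 4)
      4-pos = ℕ→ℚ-pos 3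
      2H-nonNeg : ℚ.NonNegative (ℕ→ℚ 2 ℚ.* H)
      2H-nonNeg = ℚ.nonNeg*nonNeg⇒nonNeg (ℕ→ℚ 2) {{ℕ→ℚ-nonNeg 2}} H
    regroup : ∀ two P H → (two ℚ.* P) ℚ.* (two ℚ.* H) ≡ (two ℚ.* two) ℚ.* (H ℚ.* P)
    regroup = solve 3 (λ two P H → (two :* P) :* (two :* H) := (two :* two) :* (H :* P)) refl

module Counting (q N : ℕ) (H P : ℚ) .{{_ : ℚ.NonZero P}} where

  I : ℤ → ℕ → ℕ → ℕ
  I m a k = 𝟙 (cond? q N H P m (a , k))

  I≢0⇒cond : ∀ {m a k} → I m a k ≢ 0 → Cond q N H P m (a , k)
  I≢0⇒cond {m} {a} {k} = 𝟙≢0⇒ (cond? q N H P m (a , k))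

  𝒜≡∑∑I : ∀ m → 𝒜 q N H P m ≡ ∑[ k < q ] ∑[ a < suc k ] I m a k
  𝒜≡∑∑I m = trans (length-filter≡sum-𝟙 (cond? q N H P m) (pairs q)) (sum-map-pairs q (𝟙 ∘ cond? q N H P m))

  𝒜≢0⇒cond : ∀ {m} → 𝒜 q N H P m ≢ 0 → ∃[ k ] ∃[ a ] a < suc k × Cond q N H P m (a , k)
  𝒜≢0⇒cond {m} 𝒜≢0 =
    let (k , _ , ∑I≢0) = ∑≢0⇒ q (λ k → ∑[ a < suc k ] I m a k) (𝒜≢0 ∘ trans (𝒜≡∑∑I m))
        (a , a<1+k , I≢0) = ∑≢0⇒ (suc k) (λ a → I m a k) ∑I≢0
    in k , a , a<1+k , I≢0⇒cond {m} {a} {k} I≢0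

  W : ℕ
  W = suc (4 * q)

  m[_] : ℕ → ℤ
  m[ i ] = + i ℤ.- + (2 * q)

  M : ℕ → ℕ → ℕ → ℕ → ℕ
  M a k a′ k′ = ∑[ i < W ] I m[ i ] a k * I m[ i ] a′ k′

  T : ℕ → ℕ → ℕ
  T k k′ = ∑[ a < suc k ] ∑[ a′ < suc k′ ] M a k a′ k′

  M≢0⇒cond : ∀ {a k a′ k′} → M a k a′ k′ ≢ 0 → ∃[ i ] Cond q N H P m[ i ] (a , k) × Cond q N H P m[ i ] (a′ , k′)
  M≢0⇒cond {a} {k} {a′} {k′} M≢0 =
    let (i , _ , II≢0) = ∑≢0⇒ W (λ i → I m[ i ] a k * I m[ i ] a′ k′) M≢0
    in i , I≢0⇒cond {m[ i ]} {a} {k} (m*n≢0⇒m≢0 _ _ II≢0)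
         , I≢0⇒cond {m[ i ]} {a′} {k′} (m*n≢0⇒n≢0 (I m[ i ] a k) _ II≢0)

  T≢0⇒M≢0 : ∀ {k k′} → T k k′ ≢ 0 → ∃[ a ] ∃[ a′ ] a < suc k × a′ < suc k′ × M a k a′ k′ ≢ 0
  T≢0⇒M≢0 {k} {k′} T≢0 =
    let (a , a<1+k , ∑M≢0) = ∑≢0⇒ (suc k) (λ a → ∑[ a′ < suc k′ ] M a k a′ k′) T≢0
        (a′ , a′<1+k′ , M≢0) = ∑≢0⇒ (suc k′) (λ a′ → M a k a′ k′) ∑M≢0
    in a , a′ , a<1+k , a′<1+k′ , M≢0

  S₁≤S₂ : S₁ q N H P ≤ S₂ q N H P
  S₁≤S₂ = begin
    S₁ q N H P                                      ≡⟨ sum-map-window q (𝒜 q N H P) ⟩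
    ∑[ i < W ] 𝒜 q N H P m[ i ]                     ≤⟨ ∑-mono-≤ W (λ {i} _ → n≤n*n (𝒜 q N H P m[ i ])) ⟩
    ∑[ i < W ] 𝒜 q N H P m[ i ] * 𝒜 q N H P m[ i ]  ≡⟨ sum-map-window q (λ m → 𝒜 q N H P m * 𝒜 q N H P m) ⟨
    S₂ q N H P                                      ∎
    where open ℕ.≤-Reasoning

  S₂≡∑∑T : S₂ q N H P ≡ ∑[ k < q ] ∑[ k′ < q ] T k k′
  S₂≡∑∑T = begin
    S₂ q N H P
      ≡⟨ sum-map-window q (λ m → 𝒜 q N H P m * 𝒜 q N H P m) ⟩
    ∑[ i < W ] 𝒜 q N H P m[ i ] * 𝒜 q N H P m[ i ]
      ≡⟨ ∑-cong W (λ {i} _ → square m[ i ]) ⟩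
    ∑[ i < W ] ∑[ k < q ] ∑[ k′ < q ] ∑[ a < suc k ] ∑[ a′ < suc k′ ] II i a k a′ k′
      ≡⟨ ∑-comm W q _ ⟩
    ∑[ k < q ] ∑[ i < W ] ∑[ k′ < q ] ∑[ a < suc k ] ∑[ a′ < suc k′ ] II i a k a′ k′
      ≡⟨ ∑-cong q (λ _ → ∑-comm W q _) ⟩
    ∑[ k < q ] ∑[ k′ < q ] ∑[ i < W ] ∑[ a < suc k ] ∑[ a′ < suc k′ ] II i a k a′ k′
      ≡⟨ ∑-cong q (λ {k} _ → ∑-cong q (λ _ → ∑-comm W (suc k) _)) ⟩
    ∑[ k < q ] ∑[ k′ < q ] ∑[ a < suc k ] ∑[ i < W ] ∑[ a′ < suc k′ ] II i a k a′ k′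
      ≡⟨ ∑-cong q (λ {k} _ → ∑-cong q (λ {k′} _ → ∑-cong (suc k) (λ _ → ∑-comm W (suc k′) _))) ⟩
    ∑[ k < q ] ∑[ k′ < q ] T k k′
      ∎
    where
    open ≡-Reasoning
    II : ℕ → ℕ → ℕ → ℕ → ℕ → ℕ
    II i a k a′ k′ = I m[ i ] a k * I m[ i ] a′ k′
    square : ∀ m → 𝒜 q N H P m * 𝒜 q N H P m ≡
             ∑[ k < q ] ∑[ k′ < q ] ∑[ a < suc k ] ∑[ a′ < suc k′ ] I m a k * I m a′ k′
    square m = begin
      𝒜 q N H P m * 𝒜 q N H P m
        ≡⟨ cong₂ ℕ._*_ (𝒜≡∑∑I m) (𝒜≡∑∑I m) ⟩
      (∑[ k < q ] ∑[ a < suc k ] I m a k) * (∑[ k′ < q ] ∑[ a′ < suc k′ ] I m a′ k′)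
        ≡⟨ ∑-*-∑ q q _ _ ⟩
      ∑[ k < q ] ∑[ k′ < q ] (∑[ a < suc k ] I m a k) * (∑[ a′ < suc k′ ] I m a′ k′)
        ≡⟨ ∑-cong q (λ {k} _ → ∑-cong q (λ {k′} _ → ∑-*-∑ (suc k) (suc k′) _ _)) ⟩
      ∑[ k < q ] ∑[ k′ < q ] ∑[ a < suc k ] ∑[ a′ < suc k′ ] I m a k * I m a′ k′
        ∎

module Bounds (q N : ℕ) (H P : ℚ) .{{_ : ℚ.NonZero P}}
              (1≤P : 1ℚ ℚ.≤ P) (P≤H : P ℚ.≤ H) (H<q/2 : H ℚ.< (+ q) / 2) where
  open Setting q N H P 1≤P P≤H H<q/2
  open Counting q N H P

  𝒜-support : N < q → ∀ m → 𝒜 q N H P m ≢ 0 → ∣ m ∣ ≤ 2 * q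
  𝒜-support N<q m 𝒜≢0 =
    let (k , a , a<p , c) = 𝒜≢0⇒cond {m} 𝒜≢0
    in ℕ.≤-trans (ℕ.<⇒≤ (offset⇒∣m∣<q q N N<q a<p (proj₁ (cond⇒offset {m} {a} {k} c)) (cond⇒offset<q {m} {a} {k} c)))
                 (ℕ.m≤n*m q 2)

  private
    floor-r : ∃[ n ] ℕ→ℚ n ℚ.≤ r × r ℚ.< ℕ→ℚ (suc n)
    floor-r = ∃-floor r (ℚ.nonNegative⁻¹ r)

    floor-P : ∃[ n ] ℕ→ℚ n ℚ.≤ P × P ℚ.< ℕ→ℚ (suc n)
    floor-P = ∃-floor P (ℚ.nonNegative⁻¹ P {{ℚ.pos⇒nonNeg P}})

  L : ℕ
  L = proj₁ floor-r

  L≤r : ℕ→ℚ L ℚ.≤ r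
  L≤r = proj₁ (proj₂ floor-r)

  r<1+L : r ℚ.< ℕ→ℚ (suc L)
  r<1+L = proj₂ (proj₂ floor-r)

  E : ℕ
  E = suc L

  P₀ : ℕ
  P₀ = proj₁ floor-P

  P₀≤P : ℕ→ℚ P₀ ℚ.≤ P
  P₀≤P = proj₁ (proj₂ floor-P)

  P<1+P₀ : P ℚ.< ℕ→ℚ (suc P₀)
  P<1+P₀ = proj₂ (proj₂ floor-P)

  cond-diameter : ∀ {i j a k} → Cond q N H P m[ i ] (a , k) → Cond q N H P m[ j ] (a , k) → j ≤ i + L
  cond-diameter {i} {j} {a} {k} cᵢ cⱼ =
    ℤ.drop‿+≤+ (i-j<1+k⇒i≤j+k {j = + i} L (subst (ℤ._< + suc L) (shift (+ j) (+ i) (+ (2 * q))) mⱼ-mᵢ<1+L))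
    where
    shift : ∀ j i c → (j ℤ.- c) ℤ.- (i ℤ.- c) ≡ j ℤ.- i
    shift = ℤ-solve-∀
    mⱼ-mᵢ<1+L : m[ j ] ℤ.- m[ i ] ℤ.< + suc L
    mⱼ-mᵢ<1+L = offset-diameter q N {a} {suc k} {m[ i ]} {m[ j ]} L
      (cond⇒offset<p[1+L] {m[ i ]} {a} {k} L r<1+L cᵢ) (proj₁ (cond⇒offset {m[ j ]} {a} {k} cⱼ))

  M≤E : ∀ a k a′ k′ → M a k a′ k′ ≤ E
  M≤E a k a′ k′ = ℕ.≤-trans (∑-≤-diameter W (λ i → I m[ i ] a k * I m[ i ] a′ k′) L
                              (λ {i} _ → ℕ.*-mono-≤ (𝟙≤1 (cond? q N H P m[ i ] (a , k)))
                                                    (𝟙≤1 (cond? q N H P m[ i ] (a′ , k′))))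
                              close)
                            (ℕ.≤-reflexive (ℕ.*-identityʳ E))
    where
    close : ∀ {i j} → i < W → j < W →
            I m[ i ] a k * I m[ i ] a′ k′ ≢ 0 → I m[ j ] a k * I m[ j ] a′ k′ ≢ 0 → j ≤ i + L
    close {i} {j} _ _ IIᵢ≢0 IIⱼ≢0 = cond-diameter {i} {j} {a} {k}
      (I≢0⇒cond {m[ i ]} {a} {k} (m*n≢0⇒m≢0 (I m[ i ] a k) _ IIᵢ≢0))
      (I≢0⇒cond {m[ j ]} {a} {k} (m*n≢0⇒m≢0 (I m[ j ] a k) _ IIⱼ≢0))

  T[k,k]≤[1+k]E : ∀ k → T k k ≤ suc k * E
  T[k,k]≤[1+k]E k = begin
    T k k              ≤⟨ ∑-mono-≤ (suc k) (λ {a} _ → ∑-≤-subsingleton (suc k) (λ a′ → M a k a′ k)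
                            (λ {a′} _ → M≤E a k a′ k)
                            λ {a′} {a″} _ _ M≢0 M′≢0 → trans (partner≡ {a} {a′} M≢0) (sym (partner≡ {a} {a″} M′≢0))) ⟩
    ∑[ a < suc k ] E   ≡⟨ ∑-const (suc k) E ⟩
    suc k * E          ∎
    where
    open ℕ.≤-Reasoning
    partner≡ : ∀ {a a′} → M a k a′ k ≢ 0 → a′ ≡ a
    partner≡ {a} {a′} M≢0 =
      let (i , c , c′) = M≢0⇒cond {a} {k} {a′} {k} M≢0
      in ℕ.≤-antisym
        (offset-<q⇒≤ q N {a} {a′} {suc k} {m[ i ]} (cond⇒offset<q {m[ i ]} {a} {k} c)
                                                   (proj₁ (cond⇒offset {m[ i ]} {a′} {k} c′)))
        (offset-<q⇒≤ q N {a′} {a} {suc k} {m[ i ]} (cond⇒offset<q {m[ i ]} {a′} {k} c′)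
                                                   (proj₁ (cond⇒offset {m[ i ]} {a} {k} c)))

  InRange : ℕ → Set
  InRange k = P ℚ.< ℕ→ℚ (suc k) × ℕ→ℚ (suc k) ℚ.≤ ℕ→ℚ 2 ℚ.* P

  inRange? : ∀ k → Dec (InRange k)
  inRange? k = P ℚ.<? ℕ→ℚ (suc k) ×-dec ℕ→ℚ (suc k) ℚ.≤? ℕ→ℚ 2 ℚ.* P

  T≢0⇒inRange : ∀ {k k′} → T k k′ ≢ 0 → InRange k × InRange k′
  T≢0⇒inRange {k} {k′} T≢0 =
    let (a , a′ , _ , _ , M≢0) = T≢0⇒M≢0 {k} {k′} T≢0
        (_ , (_ , P<p , p≤2P , _) , (_ , P<p′ , p′≤2P , _)) = M≢0⇒cond {a} {k} {a′} {k′} M≢0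
    in (P<p , p≤2P) , (P<p′ , p′≤2P)

  inRange⇒P₀≤k : ∀ {k} → InRange k → P₀ ≤ k
  inRange⇒P₀≤k {k} (P<p , _) = ℕ.≤-pred (ℤ.drop‿+<+ (ℤ→ℚ-cancel-< {+ P₀} {+ suc k} (ℚ.≤-<-trans P₀≤P P<p)))

  inRange⇒p<2[1+P₀] : ∀ {k} → InRange k → suc k < 2 * suc P₀
  inRange⇒p<2[1+P₀] {k} (_ , p≤2P) = ℤ.drop‿+<+ (ℤ→ℚ-cancel-< {+ suc k} {+ (2 * suc P₀)} (begin-strict
    ℕ→ℚ (suc k)             ≤⟨ p≤2P ⟩
    ℕ→ℚ 2 ℚ.* P             <⟨ ℚ.*-monoʳ-<-pos (ℕ→ℚ 2) {{ℕ→ℚ-pos 1}} P<1+P₀ ⟩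
    ℕ→ℚ 2 ℚ.* ℕ→ℚ (suc P₀)  ≡⟨ ℕ→ℚ-homo-* 2 (suc P₀) ⟨
    ℕ→ℚ (2 * suc P₀)        ∎))
    where open ℚ.≤-Reasoning

  inRange⇒k≤2P₀ : ∀ {k} → InRange k → k ≤ P₀ + P₀
  inRange⇒k≤2P₀ {k} inRange = ℕ.≤-pred (ℕ.≤-pred (begin-strict
    suc k                <⟨ inRange⇒p<2[1+P₀] inRange ⟩
    2 * suc P₀           ≡⟨ cong (suc P₀ ℕ.+_) (ℕ.+-identityʳ (suc P₀)) ⟩
    suc P₀ + suc P₀      ≡⟨ ℕ.+-suc (suc P₀) P₀ ⟩
    suc (suc (P₀ + P₀))  ∎))
    where open ℕ.≤-Reasoning

  inRange-diameter : ∀ {i j} → InRange i → InRange j → j ≤ i + P₀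
  inRange-diameter rᵢ rⱼ = ℕ.≤-trans (inRange⇒k≤2P₀ rⱼ) (ℕ.+-monoˡ-≤ P₀ (inRange⇒P₀≤k rᵢ))

  module _ (HP<q : H ℚ.* P ℚ.< ℕ→ℚ q) where

    cross-close : ∀ {k k′ a a′ b b′ m m′} →
      Cond q N H P m (a , k) → Cond q N H P m (a′ , k′) → Cond q N H P m′ (b , k) → Cond q N H P m′ (b′ , k′) →
      cross (suc k) (suc k′) b b′ ℤ.- cross (suc k) (suc k′) a a′ ℤ.< + 8
    cross-close {k} {k′} {a} {a′} {b} {b′} {m} {m′} c c′ d d′ =
      cross-window q N {suc k} {suc k′} {a} {a′} {b} {b′} {m} {m′}
      (cond⇒p′offset<4q {m} {a} {k} {k′} HP<q (proj₁ (proj₂ (proj₂ c′))) c)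
      (cond⇒p′offset<4q {m′} {b′} {k′} {k} HP<q (proj₁ (proj₂ (proj₂ d))) d′)
      (proj₁ (cond⇒offset {m} {a′} {k′} c′))
      (proj₁ (cond⇒offset {m′} {b} {k} d))

    module OffDiagonal {k k′ a₁ a₁′ m₁} (k≢k′ : k ≢ k′)
                       (c₁ : Cond q N H P m₁ (a₁ , k)) (c₁′ : Cond q N H P m₁ (a₁′ , k′)) where

      X : ℕ → ℕ → ℤ
      X = cross (suc k) (suc k′)

      x₀ : ℤ
      x₀ = X a₁ a₁′ ℤ.- + 7

      ψ : ℕ → ℕ → ℕ
      ψ a a′ = ∣ X a a′ ℤ.- x₀ ∣

      X-window : ∀ {a a′} → M a k a′ k′ ≢ 0 → 0ℤ ℤ.≤ X a a′ ℤ.- x₀ × X a a′ ℤ.- x₀ ℤ.< + 15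
      X-window {a} {a′} M≢0 =
        let (i , c , c′) = M≢0⇒cond {a} {k} {a′} {k′} M≢0
        in window-shift {X a a′} {X a₁ a₁′} 7
             (cross-close {k} {k′} {a₁} {a₁′} {a} {a′} {m₁} {m[ i ]} c₁ c₁′ c c′)
             (cross-close {k} {k′} {a} {a′} {a₁} {a₁′} {m[ i ]} {m₁} c c′ c₁ c₁′)

      ψ<15 : ∀ {a a′} → a < suc k → a′ < suc k′ → M a k a′ k′ ≢ 0 → ψ a a′ < 15
      ψ<15 {a} {a′} _ _ M≢0 = let (0≤x , x<15) = X-window {a} {a′} M≢0 in
        ℤ.drop‿+<+ (subst (ℤ._< + 15) (sym (ℤ.0≤i⇒+∣i∣≡i 0≤x)) x<15)

      ψ-injective : ∀ {a a′ b b′} → a < suc k → a′ < suc k′ → b < suc k → b′ < suc k′ →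
                    M a k a′ k′ ≢ 0 → M b k b′ k′ ≢ 0 → ψ a a′ ≡ ψ b b′ → a ≡ b × a′ ≡ b′
      ψ-injective {a} {a′} {b} {b′} a<p _ b<p _ M≢0 M′≢0 ψ≡ =
        cross-injective {suc k} {suc k′} {a} {a′} {b} {b′} (proj₁ c₁) (proj₁ c₁′) (k≢k′ ∘ ℕ.suc-injective) a<p b<p
          (∣-∣-injective-above (proj₁ (X-window {a} {a′} M≢0)) (proj₁ (X-window {b} {b′} M′≢0)) ψ≡)

      T≤15E : T k k′ ≤ 15 * E
      T≤15E = ∑∑-≤-injective (suc k) (suc k′) (λ a a′ → M a k a′ k′) ψ 15
                (λ {a} {a′} _ _ → M≤E a k a′ k′) ψ<15 ψ-injective

    T[k,k′]≤15E : ∀ {k k′} → k ≢ k′ → T k k′ ≤ 15 * E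
    T[k,k′]≤15E {k} {k′} k≢k′ = ≤-if-≢0 λ T≢0 →
      let (a₁ , a₁′ , _ , _ , M≢0) = T≢0⇒M≢0 {k} {k′} T≢0
          (i₁ , c₁ , c₁′) = M≢0⇒cond {a₁} {k} {a₁′} {k′} M≢0
      in OffDiagonal.T≤15E {k} {k′} {a₁} {a₁′} {m[ i₁ ]} k≢k′ c₁ c₁′

    ∑T-inRange : ∀ {k} → ∑[ k′ < q ] T k k′ ≢ 0 → InRange k
    ∑T-inRange {k} ∑T≢0 = let (k′ , _ , T≢0) = ∑≢0⇒ q (T k) ∑T≢0 in proj₁ (T≢0⇒inRange {k} {k′} T≢0)

    R : ℕ
    R = suc (P₀ + P₀) * E + suc P₀ * (15 * E)

    row-bound : ∀ k → ∑[ k′ < q ] T k k′ ≤ R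
    row-bound k = ≤-if-≢0 λ ∑T≢0 → begin
      ∑[ k′ < q ] T k k′  ≤⟨ ∑-≤-except q (T k) g k off-diagonal ⟩
      T k k + ∑ q g       ≤⟨ ℕ.+-mono-≤ (diagonal (∑T-inRange {k} ∑T≢0)) (∑-≤-diameter q g P₀ g≤15E g-diameter) ⟩
      R                   ∎
      where
      open ℕ.≤-Reasoning
      g : ℕ → ℕ
      g k′ = 𝟙 (inRange? k′) * (15 * E)
      g≤15E : ∀ {k′} → k′ < q → g k′ ≤ 15 * E
      g≤15E {k′} _ = 𝟙*n≤n (inRange? k′) (15 * E)
      g-diameter : ∀ {i j} → i < q → j < q → g i ≢ 0 → g j ≢ 0 → j ≤ i + P₀
      g-diameter {i} {j} _ _ gᵢ≢0 gⱼ≢0 = inRange-diameter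
        (𝟙≢0⇒ (inRange? i) (m*n≢0⇒m≢0 (𝟙 (inRange? i)) _ gᵢ≢0))
        (𝟙≢0⇒ (inRange? j) (m*n≢0⇒m≢0 (𝟙 (inRange? j)) _ gⱼ≢0))
      off-diagonal : ∀ {k′} → k′ < q → k′ ≢ k → T k k′ ≤ g k′
      off-diagonal {k′} _ k′≢k = ≤-if-≢0 λ T≢0 → ℕ.≤-trans (T[k,k′]≤15E (k′≢k ∘ sym))
        (ℕ.≤-reflexive (trans (sym (ℕ.*-identityˡ (15 * E)))
          (cong (ℕ._* (15 * E)) (sym (𝟙-yes (inRange? k′) (proj₂ (T≢0⇒inRange {k} {k′} T≢0)))))))
      diagonal : InRange k → T k k ≤ suc (P₀ + P₀) * E
      diagonal inRange = ℕ.≤-trans (T[k,k]≤[1+k]E k) (ℕ.*-monoˡ-≤ E (ℕ.s≤s (inRange⇒k≤2P₀ {k} inRange)))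

    S₂≤[1+P₀]R : S₂ q N H P ≤ suc P₀ * R
    S₂≤[1+P₀]R = begin
      S₂ q N H P                     ≡⟨ S₂≡∑∑T ⟩
      ∑[ k < q ] ∑[ k′ < q ] T k k′  ≤⟨ ∑-≤-diameter q (λ k → ∑[ k′ < q ] T k k′) P₀
                                          (λ {k} _ → row-bound k) rows-diameter ⟩
      suc P₀ * R                     ∎
      where
      open ℕ.≤-Reasoning
      rows-diameter : ∀ {i j} → i < q → j < q → ∑[ k′ < q ] T i k′ ≢ 0 → ∑[ k′ < q ] T j k′ ≢ 0 → j ≤ i + P₀
      rows-diameter {i} {j} _ _ ∑Tᵢ≢0 ∑Tⱼ≢0 = inRange-diameter (∑T-inRange {i} ∑Tᵢ≢0) (∑T-inRange {j} ∑Tⱼ≢0)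

    S₂≤132P₀²L : S₂ q N H P ≤ 132 * (P₀ * P₀ * L)
    S₂≤132P₀²L = begin
      S₂ q N H P
        ≤⟨ S₂≤[1+P₀]R ⟩
      suc P₀ * (suc (P₀ + P₀) * suc L + suc P₀ * (15 * suc L))
        ≤⟨ ℕ.*-mono-≤ 1+P₀≤2P₀ (ℕ.+-mono-≤ (ℕ.*-mono-≤ 1+2P₀≤3P₀ 1+L≤2L)
                                          (ℕ.*-mono-≤ 1+P₀≤2P₀ (ℕ.*-monoʳ-≤ 15 1+L≤2L))) ⟩
      (P₀ + P₀) * ((P₀ + (P₀ + P₀)) * (L + L) + (P₀ + P₀) * (15 * (L + L)))
        ≡⟨ collect P₀ L ⟩
      132 * (P₀ * P₀ * L)
        ∎
      where
      open ℕ.≤-Reasoning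
      collect : ∀ x y → (x + x) * ((x + (x + x)) * (y + y) + (x + x) * (15 * (y + y))) ≡ 132 * (x * x * y)
      collect = ℕ-solve-∀
      1≤P₀ : 1 ≤ P₀
      1≤P₀ = 1≤x<1+n⇒1≤n 1≤P P<1+P₀
      1≤L : 1 ≤ L
      1≤L = 1≤x<1+n⇒1≤n 1≤r r<1+L
      1+P₀≤2P₀ : suc P₀ ≤ P₀ + P₀
      1+P₀≤2P₀ = ℕ.+-monoˡ-≤ P₀ 1≤P₀
      1+2P₀≤3P₀ : suc (P₀ + P₀) ≤ P₀ + (P₀ + P₀)
      1+2P₀≤3P₀ = ℕ.+-monoˡ-≤ (P₀ + P₀) 1≤P₀
      1+L≤2L : suc L ≤ L + L
      1+L≤2L = ℕ.+-monoˡ-≤ L 1≤L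

    S₂≤132HP : ℕ→ℚ (S₂ q N H P) ℚ.≤ ℕ→ℚ 132 ℚ.* (H ℚ.* P)
    S₂≤132HP = begin
      ℕ→ℚ (S₂ q N H P)                            ≤⟨ ℤ→ℚ-mono-≤ (ℤ.+≤+ S₂≤132P₀²L) ⟩
      ℕ→ℚ (132 * (P₀ * P₀ * L))                   ≡⟨ homo ⟩
      ℕ→ℚ 132 ℚ.* (ℕ→ℚ P₀ ℚ.* ℕ→ℚ P₀ ℚ.* ℕ→ℚ L)   ≤⟨ ℚ.*-monoˡ-≤-nonNeg (ℕ→ℚ 132) {{ℕ→ℚ-nonNeg 132}}
                                                       (*-mono-≤-nonNeg (*-mono-≤-nonNeg P₀≤P P₀≤P) L≤r) ⟩
      ℕ→ℚ 132 ℚ.* (P ℚ.* P ℚ.* r)                 ≡⟨ cong (ℕ→ℚ 132 ℚ.*_) PPr≡HP ⟩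
      ℕ→ℚ 132 ℚ.* (H ℚ.* P)                       ∎
      where
      open ℚ.≤-Reasoning
      open +-*-Solver
      instance
        P₀-nonNeg : ℚ.NonNegative (ℕ→ℚ P₀)
        P₀-nonNeg = ℕ→ℚ-nonNeg P₀
        P₀²-nonNeg : ℚ.NonNegative (ℕ→ℚ P₀ ℚ.* ℕ→ℚ P₀)
        P₀²-nonNeg = ℚ.nonNeg*nonNeg⇒nonNeg (ℕ→ℚ P₀) (ℕ→ℚ P₀)
        P-nonNeg : ℚ.NonNegative P
        P-nonNeg = ℚ.pos⇒nonNeg P
      homo : ℕ→ℚ (132 * (P₀ * P₀ * L)) ≡ ℕ→ℚ 132 ℚ.* (ℕ→ℚ P₀ ℚ.* ℕ→ℚ P₀ ℚ.* ℕ→ℚ L)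
      homo = trans (ℕ→ℚ-homo-* 132 (P₀ * P₀ * L)) (cong (ℕ→ℚ 132 ℚ.*_)
               (trans (ℕ→ℚ-homo-* (P₀ * P₀) L) (cong (ℚ._* ℕ→ℚ L) (ℕ→ℚ-homo-* P₀ P₀))))
      regroup : ∀ P r → P ℚ.* P ℚ.* r ≡ (r ℚ.* P) ℚ.* P
      regroup = solve 2 (λ P r → P :* P :* r := (r :* P) :* P) refl
      PPr≡HP : P ℚ.* P ℚ.* r ≡ H ℚ.* P
      PPr≡HP = trans (regroup P r) (cong (ℚ._* P) r*P≡H)

lemma2p2 : ((q N : ℕ) (H P : ℚ) .{{_ : NonZero P}} → Prime q → N < q →
               1ℚ ℚ.≤ P → P ℚ.≤ H → H ℚ.< (+ q) / 2 →
               (m : ℤ) → 𝒜 q N H P m ≢ 0 → ∣ m ∣ ℕ.≤ 2 ℕ.* q)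
             × Σ ℕ (λ C → (q N : ℕ) (H P : ℚ) .{{_ : NonZero P}} → Prime q → N < q →
               1ℚ ℚ.≤ P → P ℚ.≤ H → H ℚ.< (+ q) / 2 → H ℚ.* P ℚ.< (+ q) / 1 →
               S₁ q N H P ℕ.≤ S₂ q N H P
               × ℕ→ℚ (S₂ q N H P) ℚ.≤ ℕ→ℚ C ℚ.* (H ℚ.* P))
lemma2p2 =
  (λ q N H P _ N<q 1≤P P≤H H<q/2 → Bounds.𝒜-support q N H P 1≤P P≤H H<q/2 N<q) ,
  132 ,
  λ q N H P _ _ 1≤P P≤H H<q/2 HP<q →
    Counting.S₁≤S₂ q N H P , Bounds.S₂≤132HP q N H P 1≤P P≤H H<q/2 HP<q
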